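{- Let $F$ be a graph of chromatic number $k$ that has a color-critical edge. Let $\mathcal{A}$ be the family of graphs $G$ that admit a proper edge-coloring containing no rainbow copy of $F$, and let $\mathcal{F}$ be the family of all other graphs. Then $(\mathcal{A},\mathcal{F})$ is an edge-critical partition.
   Context: A color-critical edge of $F$ is an edge whose deletion decreases the chromatic number. A proper edge-coloring assigns colors to edges so that edges sharing a vertex receive different colors; a rainbow copy of $F$ is a copy all of whose edges have distinct colors. A partition $(\mathcal{A},\mathcal{F})$ is a pair where $\mathcal{A}$ is a family of graphs and $\mathcal{F}$ consists of all other graphs. $T(n,k)$ is the Turán graph (complete $k$-partite on $n$ vertices with parts of size $\lfloor n/k\rfloor$ or $\lceil n/k\rceil$) and $K_n$ the complete graph. The partition is Turán-suitable if either $K_n\in\mathcal{A}$ for all large $n$, or there is an integer $k$ such that for all sufficiently large $n$, every complete $(k-1)$-partite graph with each part of order at least $n$ is in $\mathcal{A}$ and no $G\in\mathcal{A}$ contains $T(n,k)$ as a subgraph. The abstract chromatic number of a suitable partition is $\infty$ if $K_n\in\mathcal{A}$ for all large $n$; otherwise the largest $k$ such that for every sufficiently large $n$ every complete $(k-1)$-partite graph with each part of order at least $n$ is in $\mathcal{A}$. The partition is edge-critical if it is suitable with abstract chromatic number $k$ and for all sufficiently large $n$ no $G\in\mathcal{A}$ contains $T^+(n,k-1)$ as a subgraph, where $T^+(n,k-1)$ is obtained from $T(n,k-1)$ by adding one edge inside one of its smallest parts. -}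

module Defs where

open import Level using (Level)
open import Data.Nat using (ℕ; zero; suc; _+_; _∸_; _≤_; _<_; _%_)
open import Data.Nat.Properties using (m≢1+m+n; +-suc)
open import Data.Fin using (Fin; toℕ; _≟_)
open import Data.List using (length; filter; allFin)
open import Data.Product using (Σ; ∃; ∃-syntax; _×_; _,_; proj₁; proj₂)
open import Data.Sum using (_⊎_; inj₁; inj₂)
open import Relation.Nullary using (¬_)
open import Relation.Binary.PropositionalEquality using (_≡_; _≢_; refl; sym; trans)
open import Function.Definitions using (Injective)

record Graph (n : ℕ) : Set₁ where
  field
    Adj    : Fin n → Fin n → Set
    symm   : ∀ {i j} → Adj i j → Adj j i
    irrefl : ∀ {i} → ¬ Adj i i
open Graph public

Family : Set₁
Family = ∀ {m} → Graph m → Set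

Eventually : ∀ {ℓ} → (ℕ → Set ℓ) → Set ℓ
Eventually P = ∃[ N ] (∀ n → N ≤ n → P n)

_⊆_ : ∀ {m n} → Graph m → Graph n → Set
_⊆_ {m} {n} H G = Σ (Fin m → Fin n) λ φ →
  Injective _≡_ _≡_ φ × (∀ i j → Adj H i j → Adj G (φ i) (φ j))

SameEdge : ∀ {m} → Fin m → Fin m → Fin m → Fin m → Set
SameEdge i j i' j' = (i ≡ i' × j ≡ j') ⊎ (i ≡ j' × j ≡ i')

Colorable : ∀ {n} → Graph n → ℕ → Set
Colorable {n} G c = Σ (Fin n → Fin c) λ f → ∀ i j → Adj G i j → f i ≢ f j

HasChromaticNumber : ∀ {n} → Graph n → ℕ → Set
HasChromaticNumber G k = Colorable G k × (∀ c → c < k → ¬ Colorable G c)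

deleteEdge : ∀ {n} → Graph n → Fin n → Fin n → Graph n
deleteEdge G u v = record
  { Adj    = λ i j → Adj G i j × ¬ SameEdge i j u v
  ; symm   = λ { (a , ne) → symm G a , λ { (inj₁ (p , q)) → ne (inj₂ (q , p))
                                         ; (inj₂ (p , q)) → ne (inj₁ (q , p)) } }
  ; irrefl = λ { (a , _) → irrefl G a }
  }

IsColorCriticalEdge : ∀ {n} → Graph n → Fin n → Fin n → Set
IsColorCriticalEdge F u v = Adj F u v ×
  ∃[ k ] ∃[ c ] (HasChromaticNumber F k × HasChromaticNumber (deleteEdge F u v) c × c < k)

record ProperEdgeColoring {n} (G : Graph n) : Set where
  field
    col    : Fin n → Fin n → ℕ
    colSym : ∀ i j → col i j ≡ col j i
    proper : ∀ u v w → Adj G u v → Adj G u w → v ≢ w → col u v ≢ col u w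
open ProperEdgeColoring public

RainbowCopy : ∀ {m n} (F : Graph m) (G : Graph n) → ProperEdgeColoring G → Set
RainbowCopy {m} {n} F G c = Σ (Fin m → Fin n) λ φ →
  Injective _≡_ _≡_ φ × (∀ i j → Adj F i j → Adj G (φ i) (φ j)) ×
  (∀ i j i' j' → Adj F i j → Adj F i' j' →
     col c (φ i) (φ j) ≡ col c (φ i') (φ j') → SameEdge i j i' j')

NoRainbowFamily : ∀ {m} → Graph m → Family
NoRainbowFamily F G = Σ (ProperEdgeColoring G) λ c → ¬ RainbowCopy F G c

K : (n : ℕ) → Graph n
K n = record { Adj = λ i j → i ≢ j ; symm = λ ne e → ne (sym e) ; irrefl = λ ne → ne refl }

CompleteMultipartite : ∀ {m} {A : Set} → (Fin m → A) → Graph m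
CompleteMultipartite p = record
  { Adj = λ i j → p i ≢ p j ; symm = λ ne e → ne (sym e) ; irrefl = λ ne → ne refl }

partSize : ∀ {m r} → (Fin m → Fin r) → Fin r → ℕ
partSize {m} p c = length (filter (λ v → p v ≟ c) (allFin m))

-- Turán graph T(n,k): vertex i lies in part (i mod k).
-- Convention: for k = 0 (meaningless) we use k = 1, i.e. divisor suc (k ∸ 1).
turanPart : (n k : ℕ) → Fin n → ℕ
turanPart n k i = toℕ i % suc (k ∸ 1)

T : (n k : ℕ) → Graph n
T n k = CompleteMultipartite (turanPart n k)

-- T⁺(n,r): T(n,r) plus the edge between vertices s and s + suc s, where
-- s = r ∸ 1 (so r = suc s for r ≥ 1). Both lie in the part of residue s,
-- which is a smallest part of T(n,r). (If n < 2r the edge is absent.)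
private
  extra : ∀ {n} → ℕ → Fin n → Fin n → Set
  extra s i j = (toℕ i ≡ s × toℕ j ≡ s + suc s) ⊎ (toℕ j ≡ s × toℕ i ≡ s + suc s)

  extra-irr : ∀ {n} s {i : Fin n} → ¬ extra s i i
  extra-irr s (inj₁ (p , q)) = m≢1+m+n s (trans (sym p) (trans q (+-suc s s)))
  extra-irr s (inj₂ (p , q)) = m≢1+m+n s (trans (sym p) (trans q (+-suc s s)))

Tplus : (n r : ℕ) → Graph n
Tplus n r = record
  { Adj    = λ i j → Adj (T n r) i j ⊎ extra (r ∸ 1) i j
  ; symm   = λ { {i} {j} (inj₁ a) → inj₁ (symm (T n r) {i} {j} a)
               ; {i} {j} (inj₂ (inj₁ pq)) → inj₂ (inj₂ pq)
               ; {i} {j} (inj₂ (inj₂ pq)) → inj₂ (inj₁ pq) }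
  ; irrefl = λ { {i} (inj₁ a) → irrefl (T n r) {i} a ; {i} (inj₂ e) → extra-irr (r ∸ 1) {i} e }
  }

AllMultipartiteIn : Family → ℕ → ℕ → Set
AllMultipartiteIn 𝒜 k n =
  ∀ {m} (p : Fin m → Fin (k ∸ 1)) → (∀ c → n ≤ partSize p c) → 𝒜 (CompleteMultipartite p)

CompleteEventually : Family → Set
CompleteEventually 𝒜 = Eventually (λ n → 𝒜 (K n))

Suitable : Family → Set₁
Suitable 𝒜 = CompleteEventually 𝒜 ⊎
  ∃[ k ] Eventually (λ n → AllMultipartiteIn 𝒜 k n ×
                           (∀ {m} (G : Graph m) → 𝒜 G → ¬ (T n k ⊆ G)))

HasAbstractChromaticNumber : Family → ℕ → Set
HasAbstractChromaticNumber 𝒜 k =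
  ¬ CompleteEventually 𝒜 ×
  Eventually (AllMultipartiteIn 𝒜 k) ×
  (∀ k' → k < k' → ¬ Eventually (AllMultipartiteIn 𝒜 k'))

EdgeCritical : Family → Set₁
EdgeCritical 𝒜 = Suitable 𝒜 ×
  ∃[ k ] (HasAbstractChromaticNumber 𝒜 k ×
          Eventually (λ n → ∀ {m} (G : Graph m) → 𝒜 G → ¬ (Tplus n (k ∸ 1) ⊆ G)))

{-# OPTIONS --safe #-}
-- A complete (k-1)-partite graph contains no copy of F at all, F not being
-- (k-1)-colourable.  Conversely T(n,k), K_n and complete multipartite graphs with k large
-- parts contain a large blow-up of K_k, and T⁺(n,k-1) a large blow-up of K_{k-1} with one
-- edge inside a part.  Every proper edge-colouring of such a blow-up has a rainbow copy of
-- F: properly colour F with k colours (or F - uv with k-1 colours, u and v getting the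
-- colour of the part containing the extra edge, which receives uv) and embed F greedily,
-- each vertex into the part of its colour.  Since the edge-colouring is proper, a placed
-- neighbour together with a used colour rules out at most one candidate, so at most
-- m + m³ candidates are ever ruled out.
module Submission where

open import Defs
open import Data.Nat using (ℕ; suc; _+_; _*_; _∸_; _≤_; _<_; _%_; s≤s)
import Data.Nat.Properties as ℕ
open import Data.Nat.DivMod using ([m+kn]%n≡m%n; m<n⇒m%n≡m)
open import Data.Fin using (Fin; zero; suc; toℕ; fromℕ; fromℕ<; inject≤; combine; remQuot; _≟_)
open import Data.Fin.Properties
  using (toℕ-injective; toℕ-fromℕ; toℕ-fromℕ<; toℕ<n; inject≤-injective; combine-injectiveˡ;
         remQuot-combine; any?; ¬∀⟶∃¬; injective⇒≤; 1↔⊤; +↔⊎; *↔×)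
open import Data.Fin.Permutation.Components using (transpose; transpose-inverse)
open import Data.List using (List; []; _∷_; _++_; filter; allFin)
open import Data.List.Relation.Unary.Any using (here; there)
open import Data.List.Membership.Propositional using (_∈_; _∉_)
open import Data.List.Membership.Propositional.Properties
  using (∈-++⁺ˡ; ∈-++⁺ʳ; ∈-allFin; ∈-filter⁺)
open import Data.List.Membership.Setoid.Properties using (index-injective)
open import Data.Product using (Σ; ∃; ∃-syntax; _×_; _,_; -,_; proj₁; proj₂)
open import Data.Product.Function.NonDependent.Propositional using (_×-↔_)
open import Data.Sum using (_⊎_; inj₁; inj₂)
open import Data.Sum.Function.Propositional using (_⊎-↔_)
open import Data.Empty using (⊥-elim)
open import Function using (_∘_; const; _↔_; Injection)
open import Function.Definitions using (Injective)
open import Function.Properties.Inverse using (↔-refl; ↔-sym; ↔-trans; ↔⇒↣)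
open import Data.Vec.Functional using (updateAt)
open import Data.Vec.Functional.Properties using (updateAt-updates; updateAt-minimal)
open import Relation.Nullary using (¬_; Dec; yes; no)
open import Relation.Nullary.Decidable using (decidable-stable; dec-true; ¬?; _×-dec_; _⊎-dec_)
open import Relation.Unary using (Decidable)
open import Relation.Binary.PropositionalEquality
  using (_≡_; _≢_; refl; sym; trans; cong; cong₂; subst₂; setoid; module ≡-Reasoning)

private
  variable
    m n N M d r L : ℕ

SameEdge-sym : {i j i' j' : Fin m} → SameEdge i j i' j' → SameEdge i' j' i j
SameEdge-sym (inj₁ (refl , refl)) = inj₁ (refl , refl)
SameEdge-sym (inj₂ (refl , refl)) = inj₂ (refl , refl)

SameEdge-trans : {i j i' j' i'' j'' : Fin m} →
                 SameEdge i j i' j' → SameEdge i' j' i'' j'' → SameEdge i j i'' j''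
SameEdge-trans (inj₁ (refl , refl)) s                    = s
SameEdge-trans (inj₂ (refl , refl)) (inj₁ (refl , refl)) = inj₂ (refl , refl)
SameEdge-trans (inj₂ (refl , refl)) (inj₂ (refl , refl)) = inj₁ (refl , refl)

SameEdge? : (i j i' j' : Fin m) → Dec (SameEdge i j i' j')
SameEdge? i j i' j' = ((i ≟ i') ×-dec (j ≟ j')) ⊎-dec ((i ≟ j') ×-dec (j ≟ i'))

col-SameEdge : {G : Graph N} (c : ProperEdgeColoring G) (φ : Fin m → Fin N) {i j i' j' : Fin m} →
               SameEdge i j i' j' → col c (φ i) (φ j) ≡ col c (φ i') (φ j')
col-SameEdge c φ (inj₁ (refl , refl)) = refl
col-SameEdge c φ (inj₂ (refl , refl)) = colSym c _ _

col-injectiveʳ : {G : Graph N} (c : ProperEdgeColoring G) {x y y' : Fin N} →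
                 Adj G x y → Adj G x y' → col c x y ≡ col c x y' → y ≡ y'
col-injectiveʳ c {x} {y} {y'} xy xy' eq =
  decidable-stable (y ≟ y') (λ y≢y' → proper c x y y' xy xy' y≢y' eq)

sumColoring : {G : Graph N} → ProperEdgeColoring G
sumColoring = record
  { col    = λ i j → toℕ i + toℕ j
  ; colSym = λ i j → ℕ.+-comm (toℕ i) (toℕ j)
  ; proper = λ x _ _ _ _ y≢y' eq → y≢y' (toℕ-injective (ℕ.+-cancelˡ-≡ (toℕ x) _ _ eq))
  }

deleteEdge-colorable : {G : Graph n} {u v : Fin n} →
                       Colorable G d → Colorable (deleteEdge G u v) d
deleteEdge-colorable (f , f-proper) = f , λ i j → f-proper i j ∘ proj₁

colorable-mono : {G : Graph n} → d ≤ r → Colorable G d → Colorable G r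
colorable-mono d≤r (f , f-proper) =
  (λ i → inject≤ (f i) d≤r) , λ i j e eq → f-proper i j e (inject≤-injective d≤r d≤r _ _ eq)

chromatic-≤ : {G : Graph n} {k : ℕ} → HasChromaticNumber G k → Colorable G d → k ≤ d
chromatic-≤ (_ , minimal) colouring = ℕ.≮⇒≥ (λ d<k → minimal _ d<k colouring)

criticalEdge-colorable : {G : Graph n} {k : ℕ} {u v : Fin n} →
                         HasChromaticNumber G k → IsColorCriticalEdge G u v →
                         Colorable (deleteEdge G u v) (k ∸ 1)
criticalEdge-colorable {G = G} {k} χ (_ , k' , c , χ' , (colouring , _) , c<k') =
  colorable-mono {G = deleteEdge G _ _} (ℕ.∸-monoˡ-≤ {suc c} {k} 1 c<k) colouring
  where
  c<k : c < k
  c<k = ℕ.<-≤-trans c<k' (chromatic-≤ {G = G} χ' (proj₁ χ))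

endpoints-same-colour :
  {G : Graph n} {u v : Fin n} → ¬ Colorable G d →
  ((f , _) : Colorable (deleteEdge G u v) d) → f u ≡ f v
endpoints-same-colour {G = G} {u} {v} ¬colorable (f , f-proper) =
  decidable-stable (f u ≟ f v) (λ fu≢fv → ¬colorable (f , proper-on-G fu≢fv))
  where
  proper-on-G : f u ≢ f v → ∀ i j → Adj G i j → f i ≢ f j
  proper-on-G fu≢fv i j e with SameEdge? i j u v
  ... | yes (inj₁ (refl , refl)) = fu≢fv
  ... | yes (inj₂ (refl , refl)) = fu≢fv ∘ sym
  ... | no ¬uv                   = f-proper i j (e , ¬uv)

-- vertex a q is the q-th vertex of the a-th part of a copy in G of the complete
-- d-partite graph with parts of size L
record Blowup (G : Graph N) (d L : ℕ) : Set where
  field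
    vertex           : Fin d → Fin L → Fin N
    vertex-injective : ∀ a → Injective _≡_ _≡_ (vertex a)
    vertex-adjacent  : ∀ {a b} q q' → a ≢ b → Adj G (vertex a q) (vertex b q')
open Blowup

rainbowThreshold : ℕ → ℕ
rainbowThreshold m = m + m * (m * m)

rainbowThreshold↔⊎× : Fin (rainbowThreshold m) ↔ (Fin m ⊎ Fin m × Fin m × Fin m)
rainbowThreshold↔⊎× = ↔-trans +↔⊎ (↔-refl ⊎-↔ ↔-trans *↔× (↔-refl ×-↔ *↔×))

module GreedyEmbedding
  {F : Graph m} {G : Graph N} (c : ProperEdgeColoring G) (B : Blowup G d L)
  (large : rainbowThreshold m < L) {u v : Fin m} (u≢v : u ≢ v)
  (colouring : Colorable (deleteEdge F u v) d)
  {qu qv : Fin L}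
  (uv-adjacent : Adj G (vertex B (proj₁ colouring u) qu) (vertex B (proj₁ colouring v) qv))
  where

  cl : Fin m → Fin d
  cl = proj₁ colouring

  cl-proper : ∀ i j → Adj (deleteEdge F u v) i j → cl i ≢ cl j
  cl-proper = proj₂ colouring

  open import Data.List.Membership.DecPropositional (_≟_ {m}) using (_∈?_)

  image : (Fin m → Fin L) → Fin m → Fin N
  image ψ i = vertex B (cl i) (ψ i)

  colour : (Fin m → Fin L) → Fin m → Fin m → ℕ
  colour ψ i j = col c (image ψ i) (image ψ j)

  record RainbowOn (xs : List (Fin m)) (ψ : Fin m → Fin L) : Set where
    field
      at-u      : ψ u ≡ qu
      at-v      : ψ v ≡ qv
      injective : ∀ {i j} → i ∈ xs → j ∈ xs → image ψ i ≡ image ψ j → i ≡ j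
      rainbow   : ∀ {i j i' j'} → i ∈ xs → j ∈ xs → i' ∈ xs → j' ∈ xs →
                  Adj F i j → Adj F i' j' → colour ψ i j ≡ colour ψ i' j' → SameEdge i j i' j'
  open RainbowOn

  uv-image-adjacent : ∀ {ψ} → ψ u ≡ qu → ψ v ≡ qv → Adj G (image ψ u) (image ψ v)
  uv-image-adjacent refl refl = uv-adjacent

  image-adjacent : ∀ {ψ} → ψ u ≡ qu → ψ v ≡ qv →
                   ∀ i j → Adj F i j → Adj G (image ψ i) (image ψ j)
  image-adjacent ψu ψv i j e with SameEdge? i j u v
  ... | yes (inj₁ (refl , refl)) = uv-image-adjacent ψu ψv
  ... | yes (inj₂ (refl , refl)) = symm G (uv-image-adjacent ψu ψv)
  ... | no ¬uv                   = vertex-adjacent B _ _ (cl-proper i j (e , ¬uv))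

  restrict : ∀ {xs ys ψ} → (∀ {i} → i ∈ xs → i ∈ ys) → RainbowOn ys ψ → RainbowOn xs ψ
  restrict xs⊆ys R = record
    { at-u      = at-u R
    ; at-v      = at-v R
    ; injective = λ i∈ j∈ → injective R (xs⊆ys i∈) (xs⊆ys j∈)
    ; rainbow   = λ i∈ j∈ i'∈ j'∈ →
                    rainbow R (xs⊆ys i∈) (xs⊆ys j∈) (xs⊆ys i'∈) (xs⊆ys j'∈)
    }

  module Initial where
    ψ₀ : Fin m → Fin L
    ψ₀ = updateAt (const qv) u (const qu)

    ψ₀-u : ψ₀ u ≡ qu
    ψ₀-u = updateAt-updates u (const qv)

    ψ₀-v : ψ₀ v ≡ qv
    ψ₀-v = updateAt-minimal v u (const qv) (u≢v ∘ sym)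

    ∈-uv : ∀ {i} → i ∈ u ∷ v ∷ [] → i ≡ u ⊎ i ≡ v
    ∈-uv (here i≡u)         = inj₁ i≡u
    ∈-uv (there (here i≡v)) = inj₂ i≡v

    edge-uv : ∀ {i j} → i ∈ u ∷ v ∷ [] → j ∈ u ∷ v ∷ [] → Adj F i j → SameEdge i j u v
    edge-uv i∈ j∈ e with ∈-uv i∈ | ∈-uv j∈
    ... | inj₁ refl | inj₁ refl = ⊥-elim (irrefl F e)
    ... | inj₁ refl | inj₂ refl = inj₁ (refl , refl)
    ... | inj₂ refl | inj₁ refl = inj₂ (refl , refl)
    ... | inj₂ refl | inj₂ refl = ⊥-elim (irrefl F e)

    images-distinct : image ψ₀ u ≢ image ψ₀ v
    images-distinct eq = irrefl G (subst₂ (Adj G) refl (sym eq) (uv-image-adjacent ψ₀-u ψ₀-v))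

    initial : RainbowOn (u ∷ v ∷ []) ψ₀
    initial = record
      { at-u      = ψ₀-u
      ; at-v      = ψ₀-v
      ; injective = injective₀
      ; rainbow   = λ i∈ j∈ i'∈ j'∈ e e' _ →
                      SameEdge-trans (edge-uv i∈ j∈ e) (SameEdge-sym (edge-uv i'∈ j'∈ e'))
      }
      where
      injective₀ : ∀ {i j} → i ∈ u ∷ v ∷ [] → j ∈ u ∷ v ∷ [] →
                   image ψ₀ i ≡ image ψ₀ j → i ≡ j
      injective₀ i∈ j∈ eq with ∈-uv i∈ | ∈-uv j∈
      ... | inj₁ refl | inj₁ refl = refl
      ... | inj₁ refl | inj₂ refl = ⊥-elim (images-distinct eq)
      ... | inj₂ refl | inj₁ refl = ⊥-elim (images-distinct (sym eq))
      ... | inj₂ refl | inj₂ refl = refl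

  module Extend {xs ψ} (R : RainbowOn xs ψ) (u∈xs : u ∈ xs) (v∈xs : v ∈ xs)
                {w} (w∉xs : w ∉ xs) where
    candidate : Fin L → Fin N
    candidate = vertex B (cl w)

    neighbour-part : ∀ {a} → Adj F a w → cl a ≢ cl w
    neighbour-part {a} e = cl-proper a w (e , λ { (inj₁ (_ , refl)) → w∉xs v∈xs
                                                ; (inj₂ (_ , refl)) → w∉xs u∈xs })

    -- i, j range over all vertices and a over all vertices outside the part of w, so
    -- that Bad is decidable without deciding adjacency in F.
    Bad : Fin L → Set
    Bad q = (∃[ a ] image ψ a ≡ candidate q)
          ⊎ (∃[ a ] ∃[ i ] ∃[ j ]
               (cl a ≢ cl w × col c (image ψ a) (candidate q) ≡ colour ψ i j))

    bad? : Decidable Bad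
    bad? q = any? (λ a → image ψ a ≟ candidate q)
      ⊎-dec any? λ a → any? λ i → any? λ j →
              ¬? (cl a ≟ cl w) ×-dec (col c (image ψ a) (candidate q) ℕ.≟ colour ψ i j)

    code : ∀ {q} → Bad q → Fin m ⊎ Fin m × Fin m × Fin m
    code (inj₁ (a , _))         = inj₁ a
    code (inj₂ (a , i , j , _)) = inj₂ (a , i , j)

    code-injective : ∀ {q q'} (b : Bad q) (b' : Bad q') → code b ≡ code b' → q ≡ q'
    code-injective (inj₁ (a , eq)) (inj₁ (_ , eq')) refl =
      vertex-injective B (cl w) (trans (sym eq) eq')
    code-injective (inj₂ (a , _ , _ , a≁w , eq)) (inj₂ (_ , _ , _ , _ , eq')) refl =
      vertex-injective B (cl w) (col-injectiveʳ c (vertex-adjacent B _ _ a≁w)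
                                                  (vertex-adjacent B _ _ a≁w) (trans eq (sym eq')))

    good : ∃[ q ] ¬ Bad q
    good = ¬∀⟶∃¬ L Bad bad? λ all-bad →
      ℕ.<⇒≱ large (injective⇒≤ (code-injective (all-bad _) (all-bad _)
        ∘ Injection.injective (↔⇒↣ (↔-sym rainbowThreshold↔⊎×))))

    q₀ : Fin L
    q₀ = proj₁ good

    ψ' : Fin m → Fin L
    ψ' = updateAt ψ w (const q₀)

    image-new : image ψ' w ≡ candidate q₀
    image-new = cong (vertex B (cl w)) (updateAt-updates w ψ)

    ψ'-unchanged : ∀ {i} → i ≢ w → ψ' i ≡ ψ i
    ψ'-unchanged {i} i≢w = updateAt-minimal i w ψ i≢w

    ∉⇒≢ : ∀ {i} → i ∈ xs → i ≢ w
    ∉⇒≢ i∈ refl = w∉xs i∈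

    image-old : ∀ {i} → i ∈ xs → image ψ' i ≡ image ψ i
    image-old {i} i∈ = cong (vertex B (cl i)) (ψ'-unchanged (∉⇒≢ i∈))

    candidate-adjacent : ∀ {a} → Adj F a w → Adj G (candidate q₀) (image ψ a)
    candidate-adjacent e = vertex-adjacent B _ _ (neighbour-part e ∘ sym)

    data EdgeView (i j : Fin m) : Set where
      old : i ∈ xs → j ∈ xs → EdgeView i j
      new : ∀ {a} → a ∈ xs → Adj F a w → SameEdge i j a w → EdgeView i j

    view : ∀ {i j} → i ∈ w ∷ xs → j ∈ w ∷ xs → Adj F i j → EdgeView i j
    view (here refl) (here refl) e = ⊥-elim (irrefl F e)
    view (here refl) (there j∈) e  = new j∈ (symm F e) (inj₂ (refl , refl))
    view (there i∈)  (here refl) e = new i∈ e (inj₁ (refl , refl))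
    view (there i∈)  (there j∈) _  = old i∈ j∈

    viewColour : ∀ {i j} → EdgeView i j → ℕ
    viewColour {i} {j} (old _ _)   = colour ψ i j
    viewColour (new {a} _ _ _)     = col c (image ψ a) (candidate q₀)

    colour-view : ∀ {i j} (V : EdgeView i j) → colour ψ' i j ≡ viewColour V
    colour-view (old i∈ j∈)   = cong₂ (col c) (image-old i∈) (image-old j∈)
    colour-view (new a∈ _ ij) =
      trans (col-SameEdge c (image ψ') ij) (cong₂ (col c) (image-old a∈) image-new)

    rainbow-view : ∀ {i j i' j'} (V : EdgeView i j) (V' : EdgeView i' j') →
                   Adj F i j → Adj F i' j' → viewColour V ≡ viewColour V' → SameEdge i j i' j'
    rainbow-view (old i∈ j∈) (old i'∈ j'∈) e e' eq = rainbow R i∈ j∈ i'∈ j'∈ e e' eq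
    rainbow-view {i} {j} (old _ _) (new {a'} _ e' _) _ _ eq =
      ⊥-elim (proj₂ good (inj₂ (a' , i , j , neighbour-part e' , sym eq)))
    rainbow-view {i' = i'} {j'} (new {a} _ e _) (old _ _) _ _ eq =
      ⊥-elim (proj₂ good (inj₂ (a , i' , j' , neighbour-part e , eq)))
    rainbow-view (new {a} a∈ e ij) (new {a'} a'∈ e' i'j') _ _ eq
      with injective R a∈ a'∈ (col-injectiveʳ c (candidate-adjacent e) (candidate-adjacent e')
                                 (trans (colSym c _ _) (trans eq (colSym c _ _))))
    ... | refl = SameEdge-trans ij (SameEdge-sym i'j')

    extended : RainbowOn (w ∷ xs) ψ'
    extended = record
      { at-u      = trans (ψ'-unchanged (∉⇒≢ u∈xs)) (at-u R)
      ; at-v      = trans (ψ'-unchanged (∉⇒≢ v∈xs)) (at-v R)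
      ; injective = injective'
      ; rainbow   = λ i∈ j∈ i'∈ j'∈ e e' eq →
          let V = view i∈ j∈ e ; V' = view i'∈ j'∈ e' in
          rainbow-view V V' e e' (trans (sym (colour-view V)) (trans eq (colour-view V')))
      }
      where
      fresh : ∀ {j} → j ∈ xs → image ψ' w ≢ image ψ' j
      fresh {j} j∈ eq =
        proj₂ good (inj₁ (j , trans (sym (image-old j∈)) (trans (sym eq) image-new)))

      injective' : ∀ {i j} → i ∈ w ∷ xs → j ∈ w ∷ xs → image ψ' i ≡ image ψ' j → i ≡ j
      injective' (here refl) (here refl) _  = refl
      injective' (here refl) (there j∈) eq  = ⊥-elim (fresh j∈ eq)
      injective' (there i∈)  (here refl) eq = ⊥-elim (fresh i∈ (sym eq))
      injective' (there i∈)  (there j∈) eq  =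
        injective R i∈ j∈ (trans (sym (image-old i∈)) (trans eq (image-old j∈)))

  extend : ∀ {xs ψ} → u ∈ xs → v ∈ xs → RainbowOn xs ψ → ∀ w → ∃ (RainbowOn (w ∷ xs))
  extend {xs} u∈ v∈ R w with w ∈? xs
  ... | yes w∈ = -, restrict (λ { (here refl) → w∈ ; (there i∈) → i∈ }) R
  ... | no w∉  = -, Extend.extended R u∈ v∈ w∉

  embedding : ∀ ys → ∃ (RainbowOn (ys ++ u ∷ v ∷ []))
  embedding []       = -, Initial.initial
  embedding (w ∷ ys) =
    extend (∈-++⁺ʳ ys (here refl)) (∈-++⁺ʳ ys (there (here refl))) (proj₂ (embedding ys)) w

  rainbowCopy : RainbowCopy F G c
  rainbowCopy with embedding (allFin m)
  ... | ψ , R = image ψ , injective R (placed _) (placed _) , image-adjacent (at-u R) (at-v R) ,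
                λ i j i' j' → rainbow R (placed i) (placed j) (placed i') (placed j')
    where
    placed : ∀ i → i ∈ allFin m ++ u ∷ v ∷ []
    placed i = ∈-++⁺ˡ (∈-allFin i)

T⊆K : T n r ⊆ K n
T⊆K {n} {r} =
  (λ i → i) , (λ eq → eq) , λ _ _ different-parts eq → different-parts (cong (turanPart n r) eq)

module TuranVertex {n r L : ℕ} (size : L * suc r ≤ n) where
  private
    bound : ∀ (a : Fin (suc r)) (q : Fin L) → toℕ a + toℕ q * suc r < n
    bound a q = ℕ.<-≤-trans (ℕ.+-monoˡ-< (toℕ q * suc r) (toℕ<n a))
                            (ℕ.≤-trans (ℕ.*-monoˡ-≤ (suc r) (toℕ<n q)) size)

  turanVertex : Fin (suc r) → Fin L → Fin n
  turanVertex a q = fromℕ< (bound a q)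

  toℕ-turanVertex : ∀ a q → toℕ (turanVertex a q) ≡ toℕ a + toℕ q * suc r
  toℕ-turanVertex a q = toℕ-fromℕ< (bound a q)

  turanPart-turanVertex : ∀ a q → turanPart n (suc r) (turanVertex a q) ≡ toℕ a
  turanPart-turanVertex a q = begin
    toℕ (turanVertex a q) % suc r     ≡⟨ cong (_% suc r) (toℕ-turanVertex a q) ⟩
    (toℕ a + toℕ q * suc r) % suc r   ≡⟨ [m+kn]%n≡m%n (toℕ a) (toℕ q) (suc r) ⟩
    toℕ a % suc r                     ≡⟨ m<n⇒m%n≡m (toℕ<n a) ⟩
    toℕ a                             ∎
    where open ≡-Reasoning

  turanVertex-injective : ∀ a → Injective _≡_ _≡_ (turanVertex a)
  turanVertex-injective a {q} {q'} eq =
    toℕ-injective (ℕ.*-cancelʳ-≡ (toℕ q) (toℕ q') (suc r)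
      (ℕ.+-cancelˡ-≡ (toℕ a) _ _
        (trans (sym (toℕ-turanVertex a q)) (trans (cong toℕ eq) (toℕ-turanVertex a q')))))

  turan-blowup : {G : Graph N} → T n (suc r) ⊆ G → Blowup G (suc r) L
  turan-blowup (φ , φ-injective , φ-adjacent) = record
    { vertex           = λ a → φ ∘ turanVertex a
    ; vertex-injective = λ a → turanVertex-injective a ∘ φ-injective
    ; vertex-adjacent  = λ {a} {b} q q' a≢b → φ-adjacent _ _ λ eq → a≢b (toℕ-injective
        (trans (sym (turanPart-turanVertex a q)) (trans eq (turanPart-turanVertex b q'))))
    }

tplus-blowup : {G : Graph N} (size : suc (suc L) * suc r ≤ n) → Tplus n (suc r) ⊆ G →
               Σ (Blowup G (suc r) (suc (suc L)))
                 λ B → Adj G (vertex B (fromℕ r) zero) (vertex B (fromℕ r) (suc zero))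
tplus-blowup {L = L} {r} size (φ , φ-injective , φ-adjacent) =
  turan-blowup (φ , φ-injective , λ i j → φ-adjacent i j ∘ inj₁) ,
  φ-adjacent _ _ (inj₂ (inj₁ (first , second)))
  where
  open TuranVertex {r = r} {L = suc (suc L)} size
  open ≡-Reasoning
  first : toℕ (turanVertex (fromℕ r) zero) ≡ r
  first = begin
    toℕ (turanVertex (fromℕ r) zero)  ≡⟨ toℕ-turanVertex (fromℕ r) zero ⟩
    toℕ (fromℕ r) + 0                 ≡⟨ ℕ.+-identityʳ _ ⟩
    toℕ (fromℕ r)                     ≡⟨ toℕ-fromℕ r ⟩
    r                                 ∎
  second : toℕ (turanVertex (fromℕ r) (suc zero)) ≡ r + suc r
  second = begin
    toℕ (turanVertex (fromℕ r) (suc zero))  ≡⟨ toℕ-turanVertex (fromℕ r) (suc zero) ⟩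
    toℕ (fromℕ r) + (suc r + 0)             ≡⟨ cong₂ _+_ (toℕ-fromℕ r) (ℕ.+-identityʳ (suc r)) ⟩
    r + suc r                               ∎

partSize-≥ : (p : Fin M → Fin r) {a : Fin r} (f : Fin n → Fin M) →
             Injective _≡_ _≡_ f → (∀ q → p (f q) ≡ a) → n ≤ partSize p a
partSize-≥ {M} p {a} f f-injective f-in-part =
  injective⇒≤ (f-injective ∘ index-injective (setoid (Fin M)) (member _) (member _))
  where
  member : ∀ q → f q ∈ filter (λ x → p x ≟ a) (allFin M)
  member q = ∈-filter⁺ (λ x → p x ≟ a) (∈-allFin (f q)) (f-in-part q)

column : ∀ n → Fin (n * r) → Fin r
column {r} n i = proj₂ (remQuot {n} r i)

column-combine : ∀ (q : Fin n) (a : Fin r) → column n (combine q a) ≡ a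
column-combine q a = cong proj₂ (remQuot-combine q a)

partSize-column : ∀ (a : Fin r) → n ≤ partSize (column n) a
partSize-column {n = n} a = partSize-≥ (column n) (λ q → combine q a)
  (λ {q} {q'} → combine-injectiveˡ q a q' a) (λ q → column-combine q a)

column-blowup : d ≤ r → Blowup (CompleteMultipartite (column {r} n)) d n
column-blowup d≤r = record
  { vertex           = λ a q → combine q (inject≤ a d≤r)
  ; vertex-injective = λ a → combine-injectiveˡ _ _ _ _
  ; vertex-adjacent  = λ q q' a≢b eq → a≢b (inject≤-injective d≤r d≤r _ _
      (trans (sym (column-combine q _)) (trans eq (column-combine q' _))))
  }

transpose-injective : ∀ (a b : Fin n) → Injective _≡_ _≡_ (transpose a b)
transpose-injective a b {x} {y} eq = begin
  x                                  ≡⟨ transpose-inverse b a ⟨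
  transpose b a (transpose a b x)    ≡⟨ cong (transpose b a) eq ⟩
  transpose b a (transpose a b y)    ≡⟨ transpose-inverse b a ⟩
  y                                  ∎
  where open ≡-Reasoning

transpose-first : ∀ (a b : Fin n) → transpose a b a ≡ b
transpose-first a b rewrite dec-true (a ≟ a) refl = refl

recolour : {H : Graph n} (a : Fin d) ((f , _) : Colorable H d) {u v : Fin n} → f u ≡ f v →
           Σ (Colorable H d) λ (f' , _) → f' u ≡ a × f' v ≡ a
recolour a (f , f-proper) {u} fu≡fv =
  (transpose (f u) a ∘ f , λ i j e → f-proper i j e ∘ transpose-injective (f u) a) ,
  transpose-first (f u) a ,
  trans (cong (transpose (f u) a) (sym fu≡fv)) (transpose-first (f u) a)

module EdgeCriticality
  {F : Graph m} {s : ℕ} (χ : HasChromaticNumber F (2 + s))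
  {u v : Fin m} (uv : Adj F u v) (critical : Colorable (deleteEdge F u v) (suc s))
  where

  𝒜 : Family
  𝒜 = NoRainbowFamily F

  u≢v : u ≢ v
  u≢v refl = irrefl F uv

  ¬colorable : ¬ Colorable F (suc s)
  ¬colorable = proj₂ χ (suc s) (ℕ.n<1+n (suc s))

  partLength : ℕ
  partLength = 2 + rainbowThreshold m

  large : rainbowThreshold m < partLength
  large = ℕ.m<n⇒m<1+n (ℕ.n<1+n _)

  threshold : ℕ
  threshold = partLength * (2 + s)

  multipartite∈𝒜 : (p : Fin M → Fin (suc s)) → 𝒜 (CompleteMultipartite p)
  multipartite∈𝒜 p = sumColoring , λ (φ , _ , φ-adjacent , _) → ¬colorable (p ∘ φ , φ-adjacent)

  blowup∉𝒜 : {G : Graph N} → rainbowThreshold m < L → Blowup G (2 + s) L → ¬ 𝒜 G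
  blowup∉𝒜 {L = L} L-large B (c , no-rainbow) =
    no-rainbow (GreedyEmbedding.rainbowCopy {F = F} c B L-large u≢v
      (deleteEdge-colorable {G = F} (proj₁ χ)) (vertex-adjacent B q q (proj₂ (proj₁ χ) u v uv)))
    where
    q : Fin L
    q = fromℕ< L-large

  blowupWithEdge∉𝒜 : {G : Graph N} → rainbowThreshold m < L → (B : Blowup G (suc s) L) →
                     {a : Fin (suc s)} {q q' : Fin L} → Adj G (vertex B a q) (vertex B a q') → ¬ 𝒜 G
  blowupWithEdge∉𝒜 {G = G} L-large B {a} {q} {q'} edge (c , no-rainbow)
    with recolour {H = deleteEdge F u v} a critical
           (endpoints-same-colour {G = F} ¬colorable critical)
  ... | colouring , f'u≡a , f'v≡a =
    no-rainbow (GreedyEmbedding.rainbowCopy {F = F} c B L-large u≢v colouring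
      (subst₂ (λ x y → Adj G (vertex B x q) (vertex B y q')) (sym f'u≡a) (sym f'v≡a) edge))

  turan∉𝒜 : ∀ n → threshold ≤ n → ∀ {M} (G : Graph M) → 𝒜 G → ¬ (T n (2 + s) ⊆ G)
  turan∉𝒜 n size G G∈𝒜 emb = blowup∉𝒜 large (TuranVertex.turan-blowup {r = suc s} size emb) G∈𝒜

  tplus∉𝒜 : ∀ n → threshold ≤ n → ∀ {M} (G : Graph M) → 𝒜 G → ¬ (Tplus n (suc s) ⊆ G)
  tplus∉𝒜 n size G G∈𝒜 emb =
    let (B , extra) = tplus-blowup {L = rainbowThreshold m} {G = G} size' emb
    in  blowupWithEdge∉𝒜 large B {fromℕ s} {zero} {suc zero} extra G∈𝒜
    where
    size' : partLength * suc s ≤ n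
    size' = ℕ.≤-trans (ℕ.*-monoʳ-≤ partLength (ℕ.n≤1+n (suc s))) size

  complete∉𝒜 : ¬ CompleteEventually 𝒜
  complete∉𝒜 (N₀ , complete∈𝒜) =
    turan∉𝒜 order (ℕ.m≤n+m threshold N₀) (K order) (complete∈𝒜 order (ℕ.m≤m+n N₀ threshold))
      (T⊆K {r = 2 + s})
    where
    order : ℕ
    order = N₀ + threshold

  larger∉𝒜 : ∀ k → 2 + s < k → ¬ Eventually (AllMultipartiteIn 𝒜 k)
  larger∉𝒜 (suc r) (s≤s 2+s≤r) (N₀ , eventually∈𝒜) =
    blowup∉𝒜 (ℕ.<-≤-trans large (ℕ.m≤n+m partLength N₀)) (column-blowup 2+s≤r)
      (eventually∈𝒜 order (ℕ.m≤m+n N₀ partLength) (column order) partSize-column)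
    where
    order : ℕ
    order = N₀ + partLength

  edgeCritical : EdgeCritical 𝒜
  edgeCritical =
    inj₂ (2 + s , threshold , λ n size → (λ p _ → multipartite∈𝒜 p) , turan∉𝒜 n size) ,
    2 + s , (complete∉𝒜 , (0 , λ _ _ p _ → multipartite∈𝒜 p) , larger∉𝒜) , (threshold , tplus∉𝒜)

mainTheorem9 : ∀ {m} (F : Graph m) (k : ℕ) → HasChromaticNumber F k →
    (∃[ u ] ∃[ v ] IsColorCriticalEdge F u v) →
    EdgeCritical (NoRainbowFamily F)
mainTheorem9 F 0 ((f , _) , _) (u , _) with f u
... | ()
mainTheorem9 F 1 ((f , f-proper) , _) (u , v , uv , _) =
  ⊥-elim (f-proper u v uv (Injection.injective (↔⇒↣ 1↔⊤) refl))
mainTheorem9 F (suc (suc s)) χ (u , v , critical) =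
  EdgeCriticality.edgeCritical {F = F} χ (proj₁ critical)
    (criticalEdge-colorable {G = F} χ critical)
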